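{- For any prime $r\ge 5$ and any integer $k$ with $2\le k\le r-2$, the number of distinct residues modulo $r$ of the form $x^k-x^{k-1}$ with $x$ an integer and $\gcd(x,r)=1$ is less than $r-\sqrt{r/2}$. -}

module Defs where

open import Data.Nat using (ℕ; zero; suc; _∸_; _^_; _%_)
open import Data.Nat.Properties using (_≟_)
open import Data.Nat.Coprimality using (coprime?)
open import Data.List using (List; map; filter; upTo; deduplicate; length)

-- x mod r, with the convention x mod 0 = x (never used: r is prime below).
_mod_ : ℕ → ℕ → ℕ
x mod zero = x
x mod suc r = x % suc r

-- Residues modulo r are represented by x ∈ {0,…,r-1}; the residue of
-- x^k - x^(k-1) depends only on x mod r.  For x ≥ 1 and k ≥ 1 the value
-- x^k - x^(k-1) = x^(k-1)(x-1) is nonnegative, so truncated subtraction is exact.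
value : ℕ → ℕ → ℕ
value k x = (x ^ k) ∸ (x ^ (k ∸ 1))

units : ℕ → List ℕ
units r = filter (λ x → coprime? x r) (upTo r)

numResidues : ℕ → ℕ → ℕ
numResidues r k = length (deduplicate _≟_ (map (λ x → value k x mod r) (units r)))

-- Let f x = x^k − x^(k−1) on the units modulo r, and call a unit repeated when f takes
-- the same value at a smaller unit; if s units are repeated and f takes N values, then
-- s + N ≤ r − 1.  For a unit t with t^k ≠ 1 and t^(k−1) ≠ 1, the unit
-- x = (t^(k−1) − 1)/(t^k − 1) satisfies f x = f (t x) with x ≠ t x, and t is recovered
-- from the pair (x , t x).  A colliding pair has at most one unrepeated point, so there
-- are at most s² + s such t.  Every other unit is a k-th or a (k−1)-th root of unity;
-- these subgroups, of orders a and b, meet only in 1, so a b ≤ r − 1, and are proper,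
-- so 2a, 2b ≤ r − 1.  Hence a + b ≤ (r + 3)/2, s² + s ≥ (r − 3)/2, and
-- r < 2 (s + 1)² ≤ 2 (r − N)².
module Submission where

open import Algebra.Properties.CommutativeSemigroup using (interchange)
open import Data.Bool using (Bool; true; false)
open import Data.List using (List; []; _∷_; _++_; length; map; filter; cartesianProduct; applyUpTo; deduplicate)
open import Data.List.Properties using (length-++; length-map; length-applyUpTo; filter-reject; filter-all)
open import Data.List.Membership.Propositional using (_∈_; find; lose)
open import Data.List.Membership.Propositional.Properties
  using (∈-∃++; ∈-filter⁺; ∈-filter⁻; ∈-map⁺; ∈-map⁻; ∈-++⁺ˡ; ∈-++⁺ʳ; ∈-cartesianProduct⁺; ∈-cartesianProduct⁻;
         ∈-deduplicate⁻; ∈-applyUpTo⁺; ∈-applyUpTo⁻)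
open import Data.List.Relation.Binary.Subset.Propositional using (_⊆_)
open import Data.List.Relation.Unary.All as All using (All; []; _∷_)
import Data.List.Relation.Unary.All.Properties as All
open import Data.List.Relation.Unary.AllPairs using ([]; _∷_)
open import Data.List.Relation.Unary.Any using (Any; any?; here; there)
open import Data.List.Relation.Unary.Unique.Propositional using (Unique)
import Data.List.Relation.Unary.Unique.Propositional.Properties as Unique
open import Data.Nat using (ℕ; zero; suc; z<s; z≤n; s≤s; _+_; _*_; _^_; _∸_; _≤_; _<_; _<?_; _%_; nonTrivial⇒n>1)
open import Data.Nat.Properties
open import Data.Nat.Coprimality using (Coprime; coprime?; coprime⇒GCD≡1; prime⇒coprime)
import Data.Nat.Coprimality as Coprime
open import Data.Nat.Divisibility using (n∣m⇒m%n≡0; _∣0; ∣-refl)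
open import Data.Nat.DivMod using (%-distribˡ-+; %-distribˡ-*; m%n%n≡m%n; m%n<n; [m+kn]%n≡m%n; [m+n]%n≡m%n; m<n⇒m%n≡m)
open import Data.Nat.GCD using (module GCD; module Bézout)
open import Data.Nat.Induction using (<-wellFounded)
open import Data.Nat.Primality using (Prime; prime⇒irreducible; prime⇒nonTrivial)
open import Data.Nat.Tactic.RingSolver using (solve-∀)
open import Data.List.Relation.Unary.Unique.DecPropositional.Properties _≟_ using (deduplicate-!)
open import Data.Product using (∃; _×_; _,_; proj₁; proj₂)
open import Data.Sum using (_⊎_; inj₁; inj₂)
open import Function using (_∘_)
open import Induction.WellFounded using (Acc; acc)
open import Level using (0ℓ)
open import Relation.Binary.Bundles using (Setoid)
open import Relation.Binary.Definitions using (tri<; tri≈; tri>)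
open import Relation.Binary.PropositionalEquality
  using (_≡_; _≢_; refl; sym; trans; cong; cong₂; subst; subst₂; module ≡-Reasoning)
open import Relation.Binary.Structures using (IsEquivalence)
open import Relation.Nullary using (¬_; Dec; yes; no; ¬?; _×-dec_; contradiction)
open import Relation.Unary using (Decidable)

open import Defs

∈-++-∷⁻ : {A : Set} {z x : A} (ys zs : List A) → z ∈ ys ++ x ∷ zs → z ≢ x → z ∈ ys ++ zs
∈-++-∷⁻ []       zs (here refl) z≢x = contradiction refl z≢x
∈-++-∷⁻ []       zs (there z∈)  _   = z∈
∈-++-∷⁻ (y ∷ ys) zs (here refl) _   = here refl
∈-++-∷⁻ (y ∷ ys) zs (there z∈)  z≢x = there (∈-++-∷⁻ ys zs z∈ z≢x)

length-++-∷ : {A : Set} (ys zs : List A) (x : A) → length (ys ++ x ∷ zs) ≡ suc (length (ys ++ zs))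
length-++-∷ []       zs x = refl
length-++-∷ (y ∷ ys) zs x = cong suc (length-++-∷ ys zs x)

injectiveOn⇒length≤ : {A B : Set} (f : A → B) {xs : List A} {ys : List B} → Unique xs →
  (∀ {x y} → x ∈ xs → y ∈ xs → f x ≡ f y → x ≡ y) → (∀ {x} → x ∈ xs → f x ∈ ys) →
  length xs ≤ length ys
injectiveOn⇒length≤ f {[]}     _           _   _    = z≤n
injectiveOn⇒length≤ f {x ∷ xs} (x∉xs ∷ xs!) inj into
  with ys₁ , ys₂ , refl ← ∈-∃++ (into (here refl))
  rewrite length-++-∷ ys₁ ys₂ (f x) =
  s≤s (injectiveOn⇒length≤ f xs! (λ y∈ z∈ → inj (there y∈) (there z∈)) into′)
  where
  into′ : ∀ {y} → y ∈ xs → f y ∈ ys₁ ++ ys₂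
  into′ y∈ = ∈-++-∷⁻ ys₁ ys₂ (into (there y∈))
    (λ fy≡fx → All.lookup x∉xs y∈ (inj (here refl) (there y∈) (sym fy≡fx)))

⊆⇒length≤ : {A : Set} {xs ys : List A} → Unique xs → xs ⊆ ys → length xs ≤ length ys
⊆⇒length≤ xs! xs⊆ys = injectiveOn⇒length≤ (λ x → x) xs! (λ _ _ eq → eq) xs⊆ys

length-filter+length-filter-∁ : {A : Set} {P : A → Set} (P? : Decidable P) (xs : List A) →
  length (filter P? xs) + length (filter (λ x → ¬? (P? x)) xs) ≡ length xs
length-filter+length-filter-∁ P? [] = refl
length-filter+length-filter-∁ P? (x ∷ xs) with P? x
... | yes _ = cong suc (length-filter+length-filter-∁ P? xs)
... | no  _ = trans (+-suc _ _) (cong suc (length-filter+length-filter-∁ P? xs))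

length-cartesianProduct : {A B : Set} (xs : List A) (ys : List B) →
  length (cartesianProduct xs ys) ≡ length xs * length ys
length-cartesianProduct []       ys = refl
length-cartesianProduct (x ∷ xs) ys = trans (length-++ (map (x ,_) ys))
  (cong₂ _+_ (length-map (x ,_) ys) (length-cartesianProduct xs ys))

infixr 5 _∷ₘ_
data Monic : ℕ → Set where
  one  : Monic 0
  _∷ₘ_ : ∀ {n} → ℕ → Monic n → Monic (suc n)

eval : ∀ {n} → Monic n → ℕ → ℕ
eval one      t = 1
eval (c ∷ₘ P) t = c + t * eval P t

X^ : (n : ℕ) → Monic n
X^ zero    = one
X^ (suc n) = 0 ∷ₘ X^ n

eval-X^ : ∀ n t → eval (X^ n) t ≡ t ^ n
eval-X^ zero    t = refl
eval-X^ (suc n) t = cong (t *_) (eval-X^ n t)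

divideBy : ∀ {n} → ℕ → Monic (suc n) → Monic n
divideBy a (c ∷ₘ one)     = one
divideBy a (c ∷ₘ (d ∷ₘ P)) = eval (d ∷ₘ P) a ∷ₘ divideBy a (d ∷ₘ P)

-- P(t) − P(a) = (t − a)·Q(t), with the subtractions moved across.
eval-divideBy : ∀ {n} a (P : Monic (suc n)) t →
  eval P t + a * eval (divideBy a P) t ≡ t * eval (divideBy a P) t + eval P a
eval-divideBy a (c ∷ₘ one) t = regroup c t a
  where
  regroup : ∀ c t a → c + t * 1 + a * 1 ≡ t * 1 + (c + a * 1)
  regroup = solve-∀
eval-divideBy a (c ∷ₘ P@(_ ∷ₘ _)) t = begin
  c + t * Pt + a * (Pa + t * Qt)   ≡⟨ regroup c t a Pt Pa Qt ⟩
  c + a * Pa + t * (Pt + a * Qt)   ≡⟨ cong (λ u → c + a * Pa + t * u) (eval-divideBy a P t) ⟩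
  c + a * Pa + t * (t * Qt + Pa)   ≡⟨ regroup′ c t a Pa Qt ⟩
  t * (Pa + t * Qt) + (c + a * Pa) ∎
  where
  open ≡-Reasoning
  Pt Pa Qt : ℕ
  Pt = eval P t
  Pa = eval P a
  Qt = eval (divideBy a P) t
  regroup : ∀ c t a Pt Pa Qt → c + t * Pt + a * (Pa + t * Qt) ≡ c + a * Pa + t * (Pt + a * Qt)
  regroup = solve-∀
  regroup′ : ∀ c t a Pa Qt → c + a * Pa + t * (t * Qt + Pa) ≡ t * (Pa + t * Qt) + (c + a * Pa)
  regroup′ = solve-∀

module FirstOccurrences (F : ℕ → ℕ) (xs : List ℕ) where

  Repeated : ℕ → Set
  Repeated x = Any (λ y → y < x × F y ≡ F x) xs

  repeated? : Decidable Repeated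
  repeated? x = any? (λ y → (y <? x) ×-dec (F y ≟ F x)) xs

  repeats : List ℕ
  repeats = filter repeated? xs

  ∈-repeats : ∀ {x} → x ∈ xs → Repeated x → x ∈ repeats
  ∈-repeats = ∈-filter⁺ repeated?

  firsts : List ℕ
  firsts = filter (λ x → ¬? (repeated? x)) xs

  length-repeats+firsts : length repeats + length firsts ≡ length xs
  length-repeats+firsts = length-filter+length-filter-∁ repeated? xs

  F-injectiveOn-firsts : ∀ {x y} → x ∈ xs → y ∈ xs → ¬ Repeated x → ¬ Repeated y → F x ≡ F y → x ≡ y
  F-injectiveOn-firsts {x} {y} x∈ y∈ x-first y-first Fx≡Fy with <-cmp x y
  ... | tri< x<y _ _ = contradiction (lose x∈ (x<y , Fx≡Fy)) y-first
  ... | tri≈ _ x≡y _ = x≡y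
  ... | tri> _ _ y<x = contradiction (lose y∈ (y<x , sym Fx≡Fy)) x-first

  firstOccurrence : ∀ {x} → Acc _<_ x → x ∈ xs → ∃ λ e → e ∈ firsts × F e ≡ F x
  firstOccurrence {x} (acc smaller) x∈ with repeated? x
  ... | no x-first = x , ∈-filter⁺ (λ x → ¬? (repeated? x)) x∈ x-first , refl
  ... | yes x-repeated
    with y , y∈ , y<x , Fy≡Fx ← find x-repeated
    with e , e∈ , Fe≡Fy ← firstOccurrence (smaller y<x) y∈ = e , e∈ , trans Fe≡Fy Fy≡Fx

  length-deduplicate≤length-firsts : length (deduplicate _≟_ (map F xs)) ≤ length firsts
  length-deduplicate≤length-firsts =
    subst (length (deduplicate _≟_ (map F xs)) ≤_) (length-map F firsts) (⊆⇒length≤ (deduplicate-! (map F xs)) ⊆-map-firsts)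
    where
    ⊆-map-firsts : ∀ {v} → v ∈ deduplicate _≟_ (map F xs) → v ∈ map F firsts
    ⊆-map-firsts v∈ with x , x∈ , refl ← ∈-map⁻ F (∈-deduplicate⁻ _≟_ (map F xs) v∈)
                    with e , e∈ , Fe≡Fx ← firstOccurrence (<-wellFounded x) x∈
      = subst (_∈ map F firsts) Fe≡Fx (∈-map⁺ F e∈)

  record Collision (x y : ℕ) : Set where
    field
      x∈ : x ∈ xs
      y∈ : y ∈ xs
      x≢y : x ≢ y
      Fx≡Fy : F x ≡ F y

  -- A first occurrence in a collision is recovered from the other point.
  encode : ℕ → ℕ → (ℕ × ℕ) ⊎ ℕ
  encode x y with repeated? x | repeated? y
  ... | yes _ | yes _ = inj₁ (x , y)
  ... | yes _ | no  _ = inj₁ (x , x)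
  ... | no  _ | _     = inj₂ y

  codes : List ((ℕ × ℕ) ⊎ ℕ)
  codes = map inj₁ (cartesianProduct repeats repeats) ++ map inj₂ repeats

  length-codes : length codes ≡ length repeats * length repeats + length repeats
  length-codes = trans (length-++ (map inj₁ (cartesianProduct repeats repeats)))
    (cong₂ _+_ (trans (length-map inj₁ (cartesianProduct repeats repeats)) (length-cartesianProduct repeats repeats)) (length-map inj₂ repeats))

  encode-∈ : ∀ {x y} → Collision x y → encode x y ∈ codes
  encode-∈ {x} {y} record { x∈ = x∈ ; y∈ = y∈ ; x≢y = x≢y ; Fx≡Fy = Fx≡Fy } with repeated? x | repeated? y
  ... | yes x-rep   | yes y-rep  = ∈-++⁺ˡ (∈-map⁺ inj₁ (∈-cartesianProduct⁺ (∈-repeats x∈ x-rep) (∈-repeats y∈ y-rep)))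
  ... | yes x-rep   | no  _      = ∈-++⁺ˡ (∈-map⁺ inj₁ (∈-cartesianProduct⁺ (∈-repeats x∈ x-rep) (∈-repeats x∈ x-rep)))
  ... | no  _       | yes y-rep  = ∈-++⁺ʳ (map inj₁ (cartesianProduct repeats repeats)) (∈-map⁺ inj₂ (∈-repeats y∈ y-rep))
  ... | no  x-first | no y-first = contradiction (F-injectiveOn-firsts x∈ y∈ x-first y-first Fx≡Fy) x≢y

  encode-injective : ∀ {x y x′ y′} → Collision x y → Collision x′ y′ →
    encode x y ≡ encode x′ y′ → x ≡ x′ × y ≡ y′
  encode-injective {x} {y} {x′} {y′} c c′ eq
    with repeated? x | repeated? y | repeated? x′ | repeated? y′ | eq
  ... | yes _ | yes _      | yes _ | yes _       | refl = refl , refl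
  ... | yes _ | yes _      | yes _ | no  _       | refl = contradiction refl (Collision.x≢y c)
  ... | yes _ | no  _      | yes _ | yes _       | refl = contradiction refl (Collision.x≢y c′)
  ... | yes _ | no y-first | yes _ | no y′-first | refl = refl ,
    F-injectiveOn-firsts (Collision.y∈ c) (Collision.y∈ c′) y-first y′-first
      (trans (sym (Collision.Fx≡Fy c)) (Collision.Fx≡Fy c′))
  ... | no x-first | _ | no x′-first | _ | refl =
    F-injectiveOn-firsts (Collision.x∈ c) (Collision.x∈ c′) x-first x′-first
      (trans (Collision.Fx≡Fy c) (sym (Collision.Fx≡Fy c′))) , refl
  ... | yes _ | yes _ | no _  | _ | ()
  ... | yes _ | no  _ | no _  | _ | ()
  ... | no  _ | _     | yes _ | yes _ | ()
  ... | no  _ | _     | yes _ | no  _ | ()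

  length≤length-repeats² : ∀ {ts} (x y : ℕ → ℕ) → Unique ts →
    (∀ {t} → t ∈ ts → Collision (x t) (y t)) →
    (∀ {t u} → t ∈ ts → u ∈ ts → x t ≡ x u → y t ≡ y u → t ≡ u) →
    length ts ≤ length repeats * length repeats + length repeats
  length≤length-repeats² {ts} x y ts! collision injective =
    subst (length ts ≤_) length-codes (injectiveOn⇒length≤ (λ t → encode (x t) (y t)) ts!
      (λ t∈ u∈ eq → let x≡ , y≡ = encode-injective (collision t∈) (collision u∈) eq in injective t∈ u∈ x≡ y≡)
      (λ t∈ → encode-∈ (collision t∈)))

^-distribʳ-* : ∀ m n j → (m * n) ^ j ≡ m ^ j * n ^ j
^-distribʳ-* m n zero    = refl
^-distribʳ-* m n (suc j) = trans (cong (m * n *_) (^-distribʳ-* m n j)) (interchange *-commutativeSemigroup m n (m ^ j) (n ^ j))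

value+^≡^suc : ∀ j {x} → 0 < x → value (suc j) x + x ^ j ≡ x ^ suc j
value+^≡^suc j {suc x} _ = m∸n+n≡m (m≤n*m (suc x ^ j) (suc x))

module Modulo (r-1 : ℕ) where

  r : ℕ
  r = suc r-1

  -- A record rather than a synonym, so that `_%_` does not unfold and
  -- the compared numbers stay inferable.
  infix 4 _≋_ _≉_ _≋?_
  record _≋_ (a b : ℕ) : Set where
    constructor mk≋
    field ≋⇒%≡ : a % r ≡ b % r
  open _≋_ public

  _≉_ : ℕ → ℕ → Set
  a ≉ b = ¬ (a ≋ b)

  _≋?_ : (a b : ℕ) → Dec (a ≋ b)
  a ≋? b with a % r ≟ b % r
  ... | yes eq = yes (mk≋ eq)
  ... | no neq = no (λ a≋b → neq (≋⇒%≡ a≋b))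

  ≋-isEquivalence : IsEquivalence _≋_
  ≋-isEquivalence = record
    { refl  = mk≋ refl
    ; sym   = λ (mk≋ eq) → mk≋ (sym eq)
    ; trans = λ (mk≋ eq₁) (mk≋ eq₂) → mk≋ (trans eq₁ eq₂)
    }

  ≋-setoid : Setoid 0ℓ 0ℓ
  ≋-setoid = record { isEquivalence = ≋-isEquivalence }

  open IsEquivalence ≋-isEquivalence public
    using (reflexive) renaming (refl to ≋-refl; sym to ≋-sym; trans to ≋-trans)

  module ≋-Reasoning where
    open import Relation.Binary.Reasoning.Setoid ≋-setoid public

  +-cong : ∀ {a b c d} → a ≋ b → c ≋ d → a + c ≋ b + d
  +-cong {a} {b} {c} {d} (mk≋ a≋b) (mk≋ c≋d) = mk≋ (begin
    (a + c) % r           ≡⟨ %-distribˡ-+ a c r ⟩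
    (a % r + c % r) % r   ≡⟨ cong₂ (λ u v → (u + v) % r) a≋b c≋d ⟩
    (b % r + d % r) % r   ≡⟨ %-distribˡ-+ b d r ⟨
    (b + d) % r           ∎)
    where open ≡-Reasoning

  *-cong : ∀ {a b c d} → a ≋ b → c ≋ d → a * c ≋ b * d
  *-cong {a} {b} {c} {d} (mk≋ a≋b) (mk≋ c≋d) = mk≋ (begin
    (a * c) % r             ≡⟨ %-distribˡ-* a c r ⟩
    (a % r * (c % r)) % r   ≡⟨ cong₂ (λ u v → (u * v) % r) a≋b c≋d ⟩
    (b % r * (d % r)) % r   ≡⟨ %-distribˡ-* b d r ⟨
    (b * d) % r             ∎)
    where open ≡-Reasoning

  ^-congˡ : ∀ {a b} n → a ≋ b → a ^ n ≋ b ^ n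
  ^-congˡ zero    _   = ≋-refl
  ^-congˡ (suc n) a≋b = *-cong a≋b (^-congˡ n a≋b)

  %-≋ : ∀ a → a % r ≋ a
  %-≋ a = mk≋ (m%n%n≡m%n a r)

  +-*r-≋ : ∀ a c → a + c * r ≋ a
  +-*r-≋ a c = mk≋ ([m+kn]%n≡m%n a c r)

  +r-≋ : ∀ a → a + r ≋ a
  +r-≋ a = mk≋ ([m+n]%n≡m%n a r)

  +-cancelʳ-≋ : ∀ {a b} c → a + c ≋ b + c → a ≋ b
  +-cancelʳ-≋ {a} {b} c a+c≋b+c = begin
    a                      ≈⟨ +-*r-≋ a c ⟨
    a + c * suc r-1        ≡⟨ regroup a c r-1 ⟩
    a + c + r-1 * c        ≈⟨ +-cong a+c≋b+c ≋-refl ⟩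
    b + c + r-1 * c        ≡⟨ regroup b c r-1 ⟨
    b + c * suc r-1        ≈⟨ +-*r-≋ b c ⟩
    b                      ∎
    where
    open ≋-Reasoning
    regroup : ∀ x c m → x + c * suc m ≡ x + c + m * c
    regroup = solve-∀

  ≋⇒≡ : ∀ {a b} → a < r → b < r → a ≋ b → a ≡ b
  ≋⇒≡ a<r b<r (mk≋ eq) = trans (sym (m<n⇒m%n≡m a<r)) (trans eq (m<n⇒m%n≡m b<r))

  +r-1≋0⇒≋1 : ∀ {u} → u + r-1 ≋ 0 → u ≋ 1
  +r-1≋0⇒≋1 {u} u+r-1≋0 = begin
    u               ≈⟨ +r-≋ u ⟨
    u + r           ≡⟨ +-suc u r-1 ⟩
    suc (u + r-1)   ≈⟨ +-cong (≋-refl {1}) u+r-1≋0 ⟩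
    1               ∎
    where open ≋-Reasoning

  -- x·(u − 1) = v − 1, with −1 represented by r − 1 on the left and moved across on the right.
  clear-minus-one : ∀ {x u v} → x * (u + r-1) ≋ v + r-1 → x * u + 1 ≋ v + x
  clear-minus-one {x} {u} {v} eq = begin
    x * u + 1                       ≈⟨ +-*r-≋ (x * u + 1) x ⟨
    x * u + 1 + x * suc r-1         ≡⟨ regroupˡ x u r-1 ⟩
    x * (u + r-1) + (x + 1)         ≈⟨ +-cong eq (≋-refl {x + 1}) ⟩
    v + r-1 + (x + 1)               ≡⟨ regroupʳ v x r-1 ⟩
    v + x + r                       ≈⟨ +r-≋ (v + x) ⟩
    v + x                           ∎
    where
    open ≋-Reasoning
    regroupˡ : ∀ x u m → x * u + 1 + x * suc m ≡ x * (u + m) + (x + 1)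
    regroupˡ = solve-∀
    regroupʳ : ∀ v x m → v + m + (x + 1) ≡ v + x + suc m
    regroupʳ = solve-∀

  -- The equation x·(t^(j+1) − 1) = t^j − 1 (moved across) makes x and t·x collide
  -- under z ↦ z^(j+1) − z^j (moved across).
  collision-identity : ∀ j {x t} → x * t ^ suc j + 1 ≋ t ^ j + x →
    x ^ suc j + (t * x) ^ j ≋ (t * x) ^ suc j + x ^ j
  collision-identity j {x} {t} eq = begin
    x ^ suc j + (t * x) ^ j           ≡⟨ cong (x ^ suc j +_) (^-distribʳ-* t x j) ⟩
    x * A + B * A                     ≡⟨ factorˡ x A B ⟩
    A * (B + x)                       ≈⟨ *-cong (≋-refl {A}) eq ⟨
    A * (x * (t * B) + 1)             ≡⟨ factorʳ x A (t * B) ⟨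
    t * B * (x * A) + A               ≡⟨ cong (_+ A) (^-distribʳ-* t x (suc j)) ⟨
    (t * x) ^ suc j + x ^ j           ∎
    where
    open ≋-Reasoning
    A B : ℕ
    A = x ^ j
    B = t ^ j
    factorˡ : ∀ x A B → x * A + B * A ≡ A * (B + x)
    factorˡ = solve-∀
    factorʳ : ∀ x A C → C * (x * A) + A ≡ A * (x * C + 1)
    factorʳ = solve-∀

  value-≋ : ∀ j {x y} → 0 < x → 0 < y → x ^ suc j + y ^ j ≋ y ^ suc j + x ^ j →
    value (suc j) x ≋ value (suc j) y
  value-≋ j {x} {y} 0<x 0<y eq = +-cancelʳ-≋ (x ^ j + y ^ j) (begin
    value (suc j) x + (x ^ j + y ^ j)   ≡⟨ +-assoc (value (suc j) x) (x ^ j) (y ^ j) ⟨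
    value (suc j) x + x ^ j + y ^ j     ≡⟨ cong (_+ y ^ j) (value+^≡^suc j 0<x) ⟩
    x ^ suc j + y ^ j                   ≈⟨ eq ⟩
    y ^ suc j + x ^ j                   ≡⟨ cong (_+ x ^ j) (value+^≡^suc j 0<y) ⟨
    value (suc j) y + y ^ j + x ^ j     ≡⟨ +-assoc (value (suc j) y) (y ^ j) (x ^ j) ⟩
    value (suc j) y + (y ^ j + x ^ j)   ≡⟨ cong (value (suc j) y +_) (+-comm (y ^ j) (x ^ j)) ⟩
    value (suc j) y + (x ^ j + y ^ j)   ∎)
    where open ≋-Reasoning

  <r⇒≉0 : ∀ {x} → 0 < x → x < r → x ≉ 0
  <r⇒≉0 0<x x<r (mk≋ x%r≡0) = <⇒≢ 0<x (sym (trans (sym (m<n⇒m%n≡m x<r)) x%r≡0))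

  module PrimeModulus (r-prime : Prime r) where

    1<r : 1 < r
    1<r = nonTrivial⇒n>1 r {{prime⇒nonTrivial r-prime}}

    1≉0 : 1 ≉ 0
    1≉0 = <r⇒≉0 (s≤s z≤n) 1<r

    ≉0⇒coprime : ∀ {c} → c ≉ 0 → Coprime c r
    ≉0⇒coprime {c} c≉0 (d∣c , d∣r) with prime⇒irreducible r-prime d∣r
    ... | inj₁ d≡1 = d≡1
    ... | inj₂ refl = contradiction (mk≋ (n∣m⇒m%n≡0 c r d∣c)) c≉0

    -- From 1 + x·c = y·r we get x·c ≡ −1 ≡ r − 1, so (r − 1)·x inverts c.
    inverseOf : ∀ {d c} → Bézout.Identity d c r → ℕ
    inverseOf (Bézout.+- x _ _) = x
    inverseOf (Bézout.-+ x _ _) = r-1 * x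

    inverseOf-inverse : ∀ {c} (b : Bézout.Identity 1 c r) → inverseOf b * c ≋ 1
    inverseOf-inverse {c} (Bézout.+- x y 1+yr≡xc) = begin
      x * c          ≡⟨ 1+yr≡xc ⟨
      1 + y * r      ≈⟨ +-*r-≋ 1 y ⟩
      1              ∎
      where open ≋-Reasoning
    inverseOf-inverse {c} (Bézout.-+ x y 1+xc≡yr) = begin
      r-1 * x * c                   ≈⟨ +-*r-≋ _ y ⟨
      r-1 * x * c + y * r           ≡⟨ cong (r-1 * x * c +_) 1+xc≡yr ⟨
      r-1 * x * c + (1 + x * c)     ≡⟨ regroup r-1 x c ⟩
      1 + x * c * suc r-1           ≈⟨ +-*r-≋ 1 (x * c) ⟩
      1                             ∎
      where
      open ≋-Reasoning
      regroup : ∀ m x c → m * x * c + (1 + x * c) ≡ 1 + x * c * suc m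
      regroup = solve-∀

    inverse : ℕ → ℕ
    inverse c with Bézout.lemma c r
    ... | Bézout.result _ _ b = inverseOf b

    *-inverseˡ : ∀ {c} → c ≉ 0 → inverse c * c ≋ 1
    *-inverseˡ {c} c≉0 with Bézout.lemma c r
    ... | Bézout.result _ g b with refl ← GCD.unique g (coprime⇒GCD≡1 (≉0⇒coprime c≉0)) =
      inverseOf-inverse b

    *-cancelʳ-≋ : ∀ {a b c} → c ≉ 0 → a * c ≋ b * c → a ≋ b
    *-cancelʳ-≋ {a} {b} {c} c≉0 ac≋bc = begin
      a                       ≡⟨ *-identityʳ a ⟨
      a * 1                   ≈⟨ *-cong (≋-refl {a}) (*-inverseˡ c≉0) ⟨
      a * (inverse c * c)     ≡⟨ reassoc a ⟩
      a * c * inverse c       ≈⟨ *-cong ac≋bc ≋-refl ⟩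
      b * c * inverse c       ≡⟨ reassoc b ⟨
      b * (inverse c * c)     ≈⟨ *-cong (≋-refl {b}) (*-inverseˡ c≉0) ⟩
      b * 1                   ≡⟨ *-identityʳ b ⟩
      b                       ∎
      where
      open ≋-Reasoning
      reassoc : ∀ x → x * (inverse c * c) ≡ x * c * inverse c
      reassoc x = trans (cong (x *_) (*-comm (inverse c) c)) (sym (*-assoc x c (inverse c)))

    *-cancelˡ-≋ : ∀ {a b c} → c ≉ 0 → c * a ≋ c * b → a ≋ b
    *-cancelˡ-≋ {a} {b} {c} c≉0 ca≋cb =
      *-cancelʳ-≋ c≉0 (≋-trans (reflexive (*-comm a c)) (≋-trans ca≋cb (reflexive (*-comm c b))))

    *-≉0 : ∀ {a b} → a ≉ 0 → b ≉ 0 → a * b ≉ 0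
    *-≉0 a≉0 b≉0 ab≋0 = a≉0 (*-cancelʳ-≋ b≉0 ab≋0)

    inverse-≉0 : ∀ {c} → c ≉ 0 → inverse c ≉ 0
    inverse-≉0 {c} c≉0 c⁻¹≋0 = 1≉0 (≋-trans (≋-sym (*-inverseˡ c≉0)) (*-cong c⁻¹≋0 (≋-refl {c})))

    ^-≉0 : ∀ {a} j → a ≉ 0 → a ^ j ≉ 0
    ^-≉0 zero    _   = 1≉0
    ^-≉0 (suc j) a≉0 = *-≉0 a≉0 (^-≉0 j a≉0)

    divideBy-root : ∀ {n a b} (P : Monic (suc n)) → a < r → b < r → a ≢ b →
      eval P a ≋ 0 → eval P b ≋ 0 → eval (divideBy a P) b ≋ 0
    divideBy-root {a = a} {b} P a<r b<r a≢b Pa≋0 Pb≋0 with eval (divideBy a P) b ≋? 0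
    ... | yes Qb≋0 = Qb≋0
    ... | no  Qb≉0 = contradiction (≋⇒≡ a<r b<r (*-cancelʳ-≋ Qb≉0 aQ≋bQ)) a≢b
      where
      open ≋-Reasoning
      Q : ℕ
      Q = eval (divideBy a P) b
      aQ≋bQ : a * Q ≋ b * Q
      aQ≋bQ = begin
        a * Q                ≈⟨ +-cong Pb≋0 ≋-refl ⟨
        eval P b + a * Q     ≡⟨ eval-divideBy a P b ⟩
        b * Q + eval P a     ≈⟨ +-cong (≋-refl {b * Q}) Pa≋0 ⟩
        b * Q + 0            ≡⟨ +-identityʳ (b * Q) ⟩
        b * Q                ∎

    roots≤degree : ∀ {n} (P : Monic n) {ts : List ℕ} → Unique ts → All (_< r) ts →
      All (λ t → eval P t ≋ 0) ts → length ts ≤ n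
    roots≤degree P        {[]}     _            _             _             = z≤n
    roots≤degree one      {t ∷ _}  _            _             (Pt≋0 ∷ _)    = contradiction Pt≋0 1≉0
    roots≤degree P@(_ ∷ₘ _) {a ∷ ts} (a∉ts ∷ ts!) (a<r ∷ ts<r) (Pa≋0 ∷ Pts≋0) =
      s≤s (roots≤degree (divideBy a P) ts! ts<r (All.tabulate λ b∈ts →
        divideBy-root P a<r (All.lookup ts<r b∈ts) (All.lookup a∉ts b∈ts) Pa≋0 (All.lookup Pts≋0 b∈ts)))

    -- The polynomial r − 1 ∷ₘ X^ j is X^(j+1) − 1.
    roots-of-unity≤degree : ∀ j {ts : List ℕ} → Unique ts → All (_< r) ts →
      All (λ t → t ^ suc j ≋ 1) ts → length ts ≤ suc j
    roots-of-unity≤degree j ts! ts<r ts^j≋1 = roots≤degree (r-1 ∷ₘ X^ j) ts! ts<r (All.map (λ {t} → root {t}) ts^j≋1)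
      where
      root : ∀ {t} → t ^ suc j ≋ 1 → eval (r-1 ∷ₘ X^ j) t ≋ 0
      root {t} t^j≋1 = begin
        r-1 + t * eval (X^ j) t   ≡⟨ cong (λ u → r-1 + t * u) (eval-X^ j t) ⟩
        r-1 + t ^ suc j           ≈⟨ +-cong (≋-refl {r-1}) t^j≋1 ⟩
        r-1 + 1                   ≡⟨ +-comm r-1 1 ⟩
        r                         ≈⟨ +r-≋ 0 ⟩
        0                         ∎
        where open ≋-Reasoning

    units≡applyUpTo-suc : units r ≡ applyUpTo suc r-1
    units≡applyUpTo-suc = trans (filter-reject coprime-to-r? 0-not-coprime)
                     (filter-all coprime-to-r? (All.applyUpTo⁺₁ suc r-1 λ i<r-1 →
                       Coprime.sym (prime⇒coprime r-prime (s≤s i<r-1))))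
      where
      coprime-to-r? : Decidable (λ x → Coprime x r)
      coprime-to-r? x = coprime? x r
      0-not-coprime : ¬ Coprime 0 r
      0-not-coprime coprime = <⇒≢ 1<r (sym (coprime (r ∣0 , ∣-refl)))

    ∈-units⁺ : ∀ {x} → 0 < x → x < r → x ∈ units r
    ∈-units⁺ {suc x} _ (s≤s x<r-1) rewrite units≡applyUpTo-suc = ∈-applyUpTo⁺ suc x<r-1

    ∈-units⁻ : ∀ {x} → x ∈ units r → 0 < x × x < r
    ∈-units⁻ x∈ rewrite units≡applyUpTo-suc with _ , i<r-1 , refl ← ∈-applyUpTo⁻ suc x∈ = s≤s z≤n , s≤s i<r-1

    units-<r : All (_< r) (units r)
    units-<r = All.tabulate (λ x∈ → proj₂ (∈-units⁻ x∈))

    unit⇒≉0 : ∀ {x} → x ∈ units r → x ≉ 0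
    unit⇒≉0 x∈ = let 0<x , x<r = ∈-units⁻ x∈ in <r⇒≉0 0<x x<r

    units-≋⇒≡ : ∀ {x y} → x ∈ units r → y ∈ units r → x ≋ y → x ≡ y
    units-≋⇒≡ x∈ y∈ = ≋⇒≡ (proj₂ (∈-units⁻ x∈)) (proj₂ (∈-units⁻ y∈))

    %-∈-units : ∀ {a} → a ≉ 0 → a % r ∈ units r
    %-∈-units {a} a≉0 = ∈-units⁺ (n≢0⇒n>0 λ a%r≡0 → a≉0 (mk≋ a%r≡0)) (m%n<n a r)

    units-unique : Unique (units r)
    units-unique rewrite units≡applyUpTo-suc = Unique.applyUpTo⁺₁ suc r-1 λ i<j _ → <⇒≢ (s≤s i<j)

    length-units : length (units r) ≡ r-1
    length-units rewrite units≡applyUpTo-suc = length-applyUpTo suc r-1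

    ^-*-≋1ʳ : ∀ {a b} j → b ^ j ≋ 1 → (a * b) ^ j ≋ a ^ j
    ^-*-≋1ʳ {a} {b} j b^j≋1 = begin
      (a * b) ^ j       ≡⟨ ^-distribʳ-* a b j ⟩
      a ^ j * b ^ j     ≈⟨ *-cong (≋-refl {a ^ j}) b^j≋1 ⟩
      a ^ j * 1         ≡⟨ *-identityʳ (a ^ j) ⟩
      a ^ j             ∎
      where open ≋-Reasoning

    ≋-by-consecutive-powers : ∀ {a a′} j → a ≉ 0 → a ^ j ≋ a′ ^ j → a ^ suc j ≋ a′ ^ suc j → a ≋ a′
    ≋-by-consecutive-powers {a} {a′} j a≉0 a^j≋ a^sj≋ = *-cancelʳ-≋ (^-≉0 j a≉0) (begin
      a * a ^ j       ≈⟨ a^sj≋ ⟩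
      a′ * a′ ^ j     ≈⟨ *-cong (≋-refl {a′}) a^j≋ ⟨
      a′ * a ^ j      ∎)
      where open ≋-Reasoning

    rootsOfUnity : ℕ → List ℕ
    rootsOfUnity j = filter (λ t → t ^ j ≋? 1) (units r)

    ∈-rootsOfUnity⁻ : ∀ j {t} → t ∈ rootsOfUnity j → t ∈ units r × t ^ j ≋ 1
    ∈-rootsOfUnity⁻ j = ∈-filter⁻ (λ t → t ^ j ≋? 1)

    ∈-rootsOfUnity⁺ : ∀ j {t} → t ∈ units r → t ^ j ≋ 1 → t ∈ rootsOfUnity j
    ∈-rootsOfUnity⁺ j = ∈-filter⁺ (λ t → t ^ j ≋? 1)

    1∈rootsOfUnity : ∀ j → 1 ∈ rootsOfUnity j
    1∈rootsOfUnity j = ∈-rootsOfUnity⁺ j (∈-units⁺ (s≤s z≤n) 1<r) (reflexive (^-zeroˡ j))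

    rootsOfUnity-unique : ∀ j → Unique (rootsOfUnity j)
    rootsOfUnity-unique j = Unique.filter⁺ (λ t → t ^ j ≋? 1) units-unique

    ∃-non-root-of-unity : ∀ j → suc j < r-1 → ∃ λ g → g ∈ units r × g ^ suc j ≉ 1
    ∃-non-root-of-unity j j<r-1 with All.all? (λ t → t ^ suc j ≋? 1) (units r)
    ... | yes all-roots = contradiction (roots-of-unity≤degree j units-unique units-<r all-roots)
                                        (<⇒≱ (subst (suc j <_) (sym length-units) j<r-1))
    ... | no ¬all-roots = find (All.¬All⇒Any¬ (λ t → t ^ suc j ≋? 1) (units r) ¬all-roots)

    -- rootsOfUnity j and its translate by g are disjoint subsets of the units.
    non-root⇒2*length-rootsOfUnity≤ : ∀ {j g} → g ∈ units r → g ^ j ≉ 1 → 2 * length (rootsOfUnity j) ≤ r-1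
    non-root⇒2*length-rootsOfUnity≤ {j} {g} g∈ g^j≉1 =
      subst₂ _≤_ (length-cartesianProduct (true ∷ false ∷ []) μ) length-units
        (injectiveOn⇒length≤ f (Unique.cartesianProduct⁺ (((λ ()) ∷ []) ∷ [] ∷ []) (rootsOfUnity-unique j)) f-injective f-into)
      where
      μ : List ℕ
      μ = rootsOfUnity j

      Domain : List (Bool × ℕ)
      Domain = cartesianProduct (true ∷ false ∷ []) μ

      f : Bool × ℕ → ℕ
      f (true  , a) = a
      f (false , a) = g * a % r

      root : ∀ {b a} → (b , a) ∈ Domain → a ∈ μ
      root {b} {a} p = proj₂ (∈-cartesianProduct⁻ (true ∷ false ∷ []) μ {b , a} p)

      translate-∉ : ∀ {a a′} → a ∈ μ → a′ ∈ μ → g * a ≉ a′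
      translate-∉ {a} {a′} a∈ a′∈ ga≋a′ = g^j≉1 (begin
        g ^ j          ≈⟨ ^-*-≋1ʳ j (proj₂ (∈-rootsOfUnity⁻ j a∈)) ⟨
        (g * a) ^ j    ≈⟨ ^-congˡ j ga≋a′ ⟩
        a′ ^ j         ≈⟨ proj₂ (∈-rootsOfUnity⁻ j a′∈) ⟩
        1              ∎)
        where open ≋-Reasoning

      unit : ∀ {a} → a ∈ μ → a ∈ units r
      unit a∈ = proj₁ (∈-rootsOfUnity⁻ j a∈)

      f-into : ∀ {p} → p ∈ Domain → f p ∈ units r
      f-into {true  , a} p∈ = unit (root p∈)
      f-into {false , a} p∈ = %-∈-units (*-≉0 (unit⇒≉0 g∈) (unit⇒≉0 (unit (root p∈))))

      f-injective : ∀ {p q} → p ∈ Domain → q ∈ Domain → f p ≡ f q → p ≡ q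
      f-injective {true  , a} {true  , a′} _  _  refl = refl
      f-injective {false , a} {false , a′} p∈ q∈ ga≡ga′ = cong (false ,_)
        (units-≋⇒≡ (unit (root p∈)) (unit (root q∈)) (*-cancelˡ-≋ (unit⇒≉0 g∈) (mk≋ ga≡ga′)))
      f-injective {true  , a} {false , a′} p∈ q∈ a≡ga′ =
        contradiction (≋-trans (≋-sym (%-≋ (g * a′))) (reflexive (sym a≡ga′))) (translate-∉ (root q∈) (root p∈))
      f-injective {false , a} {true  , a′} p∈ q∈ ga≡a′ =
        contradiction (≋-trans (≋-sym (%-≋ (g * a))) (reflexive ga≡a′)) (translate-∉ (root p∈) (root q∈))

    2*length-rootsOfUnity-suc≤ : ∀ j → suc j < r-1 → 2 * length (rootsOfUnity (suc j)) ≤ r-1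
    2*length-rootsOfUnity-suc≤ j j<r-1 =
      let g , g∈ , g^j≉1 = ∃-non-root-of-unity j j<r-1 in non-root⇒2*length-rootsOfUnity≤ {suc j} g∈ g^j≉1

    1≤length-rootsOfUnity : ∀ j → 1 ≤ length (rootsOfUnity j)
    1≤length-rootsOfUnity j = ⊆⇒length≤ {xs = 1 ∷ []} ([] ∷ []) λ { (here refl) → 1∈rootsOfUnity j }

    -- Roots of unity of coprime orders j+1 and j meet only in 1, so (a , b) ↦ a·b is injective.
    length-rootsOfUnity-suc*≤ : ∀ j → length (rootsOfUnity (suc j)) * length (rootsOfUnity j) ≤ r-1
    length-rootsOfUnity-suc*≤ j =
      subst₂ _≤_ (length-cartesianProduct μ′ μ) length-units
        (injectiveOn⇒length≤ f (Unique.cartesianProduct⁺ (rootsOfUnity-unique (suc j)) (rootsOfUnity-unique j))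
          f-injective f-into)
      where
      μ′ μ : List ℕ
      μ′ = rootsOfUnity (suc j)
      μ  = rootsOfUnity j

      f : ℕ × ℕ → ℕ
      f (a , b) = a * b % r

      components : ∀ {a b} → (a , b) ∈ cartesianProduct μ′ μ →
        (a ∈ units r × a ^ suc j ≋ 1) × (b ∈ units r × b ^ j ≋ 1)
      components {a} {b} p∈ = let a∈ , b∈ = ∈-cartesianProduct⁻ μ′ μ {a , b} p∈ in
        ∈-rootsOfUnity⁻ (suc j) a∈ , ∈-rootsOfUnity⁻ j b∈

      f-into : ∀ {p} → p ∈ cartesianProduct μ′ μ → f p ∈ units r
      f-into p∈ = let (a∈ , _) , (b∈ , _) = components p∈ in %-∈-units (*-≉0 (unit⇒≉0 a∈) (unit⇒≉0 b∈))

      f-injective : ∀ {p q} → p ∈ cartesianProduct μ′ μ → q ∈ cartesianProduct μ′ μ → f p ≡ f q → p ≡ q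
      f-injective {a , b} {a′ , b′} p∈ q∈ ab%≡a′b′%
        with (a∈ , a^sj≋1) , (b∈ , b^j≋1) ← components p∈
           | (a′∈ , a′^sj≋1) , (b′∈ , b′^j≋1) ← components q∈ =
        cong₂ _,_ (units-≋⇒≡ a∈ a′∈ a≋a′) (units-≋⇒≡ b∈ b′∈ b≋b′)
        where
        open ≋-Reasoning
        ab≋a′b′ : a * b ≋ a′ * b′
        ab≋a′b′ = mk≋ ab%≡a′b′%

        a^j≋a′^j : a ^ j ≋ a′ ^ j
        a^j≋a′^j = begin
          a ^ j            ≈⟨ ^-*-≋1ʳ j b^j≋1 ⟨
          (a * b) ^ j      ≈⟨ ^-congˡ j ab≋a′b′ ⟩
          (a′ * b′) ^ j    ≈⟨ ^-*-≋1ʳ j b′^j≋1 ⟩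
          a′ ^ j           ∎

        a≋a′ : a ≋ a′
        a≋a′ = ≋-by-consecutive-powers j (unit⇒≉0 a∈) a^j≋a′^j (≋-trans a^sj≋1 (≋-sym a′^sj≋1))

        b≋b′ : b ≋ b′
        b≋b′ = *-cancelˡ-≋ (unit⇒≉0 a∈) (≋-trans ab≋a′b′ (*-cong (≋-sym a≋a′) (≋-refl {b′})))

    module Exponent (k-1 : ℕ) where

      k : ℕ
      k = suc k-1

      residue : ℕ → ℕ
      residue x = value k x mod r

      open FirstOccurrences residue (units r) public

      Generic : ℕ → Set
      Generic t = t ^ k ≉ 1 × t ^ k-1 ≉ 1

      generic? : Decidable Generic
      generic? t = ¬? (t ^ k ≋? 1) ×-dec ¬? (t ^ k-1 ≋? 1)

      generic : List ℕ
      generic = filter generic? (units r)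

      nonGeneric : List ℕ
      nonGeneric = filter (λ t → ¬? (generic? t)) (units r)

      -- base t = (t^(k−1) − 1)/(t^k − 1), with −1 represented by r − 1.
      base : ℕ → ℕ
      base t = (t ^ k-1 + r-1) * inverse (t ^ k + r-1) % r

      translate : ℕ → ℕ
      translate t = t * base t % r

      module _ {t} (t∈ : t ∈ generic) where

        private
          t∈units : t ∈ units r
          t∈units = proj₁ (∈-filter⁻ generic? {xs = units r} t∈)
          t^k≉1 : t ^ k ≉ 1
          t^k≉1 = proj₁ (proj₂ (∈-filter⁻ generic? {xs = units r} t∈))
          t^k-1≉1 : t ^ k-1 ≉ 1
          t^k-1≉1 = proj₂ (proj₂ (∈-filter⁻ generic? {xs = units r} t∈))
          den≉0 : t ^ k + r-1 ≉ 0
          den≉0 = t^k≉1 ∘ +r-1≋0⇒≋1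
          num≉0 : t ^ k-1 + r-1 ≉ 0
          num≉0 = t^k-1≉1 ∘ +r-1≋0⇒≋1
          quotient≉0 : (t ^ k-1 + r-1) * inverse (t ^ k + r-1) ≉ 0
          quotient≉0 = *-≉0 num≉0 (inverse-≉0 den≉0)

        base≉0 : base t ≉ 0
        base≉0 = quotient≉0 ∘ ≋-trans (≋-sym (%-≋ _))

        base∈units : base t ∈ units r
        base∈units = %-∈-units quotient≉0

        translate≋ : translate t ≋ t * base t
        translate≋ = %-≋ (t * base t)

        translate∈units : translate t ∈ units r
        translate∈units = %-∈-units (*-≉0 (unit⇒≉0 t∈units) base≉0)

        base-equation : base t * (t ^ k + r-1) ≋ t ^ k-1 + r-1
        base-equation = begin
          base t * den                   ≈⟨ *-cong (%-≋ (num * inverse den)) (≋-refl {den}) ⟩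
          num * inverse den * den        ≡⟨ *-assoc num (inverse den) den ⟩
          num * (inverse den * den)      ≈⟨ *-cong (≋-refl {num}) (*-inverseˡ den≉0) ⟩
          num * 1                        ≡⟨ *-identityʳ num ⟩
          num                            ∎
          where
          open ≋-Reasoning
          num den : ℕ
          num = t ^ k-1 + r-1
          den = t ^ k + r-1

        base-collision : Collision (base t) (translate t)
        base-collision = record
          { x∈ = base∈units
          ; y∈ = translate∈units
          ; x≢y = base≢translate
          ; Fx≡Fy = ≋⇒%≡ (value-≋ k-1 (positive base∈units) (positive translate∈units) (begin
              base t ^ k + translate t ^ k-1     ≈⟨ +-cong (≋-refl {base t ^ k}) (^-congˡ k-1 translate≋) ⟩
              base t ^ k + (t * base t) ^ k-1    ≈⟨ collision-identity k-1 (clear-minus-one base-equation) ⟩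
              (t * base t) ^ k + base t ^ k-1    ≈⟨ +-cong (^-congˡ k translate≋) (≋-refl {base t ^ k-1}) ⟨
              translate t ^ k + base t ^ k-1     ∎))
          }
          where
          open ≋-Reasoning
          positive : ∀ {x} → x ∈ units r → 0 < x
          positive x∈ = proj₁ (∈-units⁻ x∈)
          base≢translate : base t ≢ translate t
          base≢translate eq = t^k≉1 (begin
            t ^ k     ≈⟨ ^-congˡ k (*-cancelʳ-≋ {1} {t} base≉0 (≋-trans (reflexive (trans (*-identityˡ (base t)) eq)) translate≋)) ⟨
            1 ^ k     ≡⟨ ^-zeroˡ k ⟩
            1         ∎)

      length-generic≤ : length generic ≤ length repeats * length repeats + length repeats
      length-generic≤ =
        length≤length-repeats² base translate (Unique.filter⁺ generic? units-unique) base-collision injective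
        where
        unit : ∀ {t} → t ∈ generic → t ∈ units r
        unit = proj₁ ∘ ∈-filter⁻ generic? {xs = units r}
        injective : ∀ {t u} → t ∈ generic → u ∈ generic → base t ≡ base u → translate t ≡ translate u → t ≡ u
        injective {t} {u} t∈ u∈ bt≡bu tt≡tu = units-≋⇒≡ (unit t∈) (unit u∈) (*-cancelʳ-≋ (base≉0 t∈) (begin
          t * base t      ≈⟨ translate≋ t∈ ⟨
          translate t     ≡⟨ tt≡tu ⟩
          translate u     ≈⟨ translate≋ u∈ ⟩
          u * base u      ≡⟨ cong (u *_) bt≡bu ⟨
          u * base t      ∎))
          where open ≋-Reasoning

      -- Non-generic units are k-th or (k−1)-th roots of unity, and 1 is both.
      suc-length-nonGeneric≤ : suc (length nonGeneric) ≤ length (rootsOfUnity k) + length (rootsOfUnity k-1)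
      suc-length-nonGeneric≤ = begin
        suc (length nonGeneric)                      ≤⟨ s≤s (⊆⇒length≤ (Unique.filter⁺ (¬? ∘ generic?) units-unique) ⊆-μ++μ′) ⟩
        suc (length (μ ++ μ′))                       ≡⟨ cong suc (length-++ μ) ⟩
        suc (length μ + length μ′)                   ≡⟨ +-suc (length μ) (length μ′) ⟨
        length μ + suc (length μ′)                   ≤⟨ +-monoʳ-≤ (length μ) (⊆⇒length≤ 1∷μ′-unique 1∷μ′⊆μ-1) ⟩
        length μ + length (rootsOfUnity k-1)         ∎
        where
        open ≤-Reasoning
        ≢1? : Decidable (_≢ 1)
        ≢1? t = ¬? (t ≟ 1)

        μ μ′ : List ℕ
        μ = rootsOfUnity k
        μ′ = filter ≢1? (rootsOfUnity k-1)

        1∷μ′-unique : Unique (1 ∷ μ′)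
        1∷μ′-unique = All.tabulate (λ t∈ 1≡t → proj₂ (∈-filter⁻ ≢1? {xs = rootsOfUnity k-1} t∈) (sym 1≡t))
                    ∷ Unique.filter⁺ ≢1? (rootsOfUnity-unique k-1)

        1∷μ′⊆μ-1 : ∀ {t} → t ∈ 1 ∷ μ′ → t ∈ rootsOfUnity k-1
        1∷μ′⊆μ-1 (here refl) = 1∈rootsOfUnity k-1
        1∷μ′⊆μ-1 (there t∈) = proj₁ (∈-filter⁻ ≢1? {xs = rootsOfUnity k-1} t∈)

        ⊆-μ++μ′ : ∀ {t} → t ∈ nonGeneric → t ∈ μ ++ μ′
        ⊆-μ++μ′ {t} t∈ with ∈-filter⁻ (¬? ∘ generic?) {xs = units r} t∈
        ... | t∈units , non-generic with t ^ k ≋? 1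
        ...   | yes t^k≋1 = ∈-++⁺ˡ (∈-rootsOfUnity⁺ k t∈units t^k≋1)
        ...   | no  t^k≉1 with t ^ k-1 ≋? 1
        ...     | no  t^k-1≉1 = contradiction (t^k≉1 , t^k-1≉1) non-generic
        ...     | yes t^k-1≋1 = ∈-++⁺ʳ μ (∈-filter⁺ ≢1? (∈-rootsOfUnity⁺ k-1 t∈units t^k-1≋1)
                                  λ { refl → t^k≉1 (reflexive (^-zeroˡ k)) })

      r≤generic+rootsOfUnity : r ≤ length generic + (length (rootsOfUnity k) + length (rootsOfUnity k-1))
      r≤generic+rootsOfUnity = begin
        suc r-1                                       ≡⟨ cong suc (trans (sym length-units)
                                                           (sym (length-filter+length-filter-∁ generic? (units r)))) ⟩
        suc (length generic + length nonGeneric)      ≡⟨ +-suc (length generic) (length nonGeneric) ⟨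
        length generic + suc (length nonGeneric)      ≤⟨ +-monoʳ-≤ (length generic) suc-length-nonGeneric≤ ⟩
        length generic + (length (rootsOfUnity k) + length (rootsOfUnity k-1)) ∎
        where open ≤-Reasoning

2*[a+b]≤ : ∀ m a b → 1 ≤ a → 1 ≤ b → a * b ≤ m → 2 * a ≤ m → 2 * b ≤ m → 2 * (a + b) ≤ m + 4
2*[a+b]≤ m 1 b _ _ _ _ 2b≤m = begin
  2 * (1 + b)   ≡⟨ *-distribˡ-+ 2 1 b ⟩
  2 + 2 * b     ≤⟨ +-monoʳ-≤ 2 2b≤m ⟩
  2 + m         ≤⟨ +-monoˡ-≤ m (s≤s (s≤s z≤n)) ⟩
  4 + m         ≡⟨ +-comm 4 m ⟩
  m + 4         ∎
  where open ≤-Reasoning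
2*[a+b]≤ m a 1 _ _ _ 2a≤m _ = begin
  2 * (a + 1)   ≡⟨ *-distribˡ-+ 2 a 1 ⟩
  2 * a + 2     ≤⟨ +-monoˡ-≤ 2 2a≤m ⟩
  m + 2         ≤⟨ +-monoʳ-≤ m (s≤s (s≤s z≤n)) ⟩
  m + 4         ∎
  where open ≤-Reasoning
-- (a − 2)(b − 2) ≥ 0 once both are at least 2.
2*[a+b]≤ m (suc (suc a)) (suc (suc b)) _ _ ab≤m _ _ = begin
  2 * (2 + a + (2 + b))                 ≡⟨ expand₁ a b ⟩
  4 + (4 + (2 * a + 2 * b))             ≤⟨ +-monoʳ-≤ 4 (m≤m+n _ (a * b)) ⟩
  4 + (4 + (2 * a + 2 * b) + a * b)     ≡⟨ cong (4 +_) (expand₂ a b) ⟨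
  4 + (2 + a) * (2 + b)                 ≤⟨ +-monoʳ-≤ 4 ab≤m ⟩
  4 + m                                 ≡⟨ +-comm 4 m ⟩
  m + 4                                 ∎
  where
  open ≤-Reasoning
  expand₁ : ∀ a b → 2 * (2 + a + (2 + b)) ≡ 4 + (4 + (2 * a + 2 * b))
  expand₁ = solve-∀
  expand₂ : ∀ a b → (2 + a) * (2 + b) ≡ 4 + (2 * a + 2 * b) + a * b
  expand₂ = solve-∀

counting⇒bound : ∀ m a b g s N → 4 ≤ m → 1 ≤ a → 1 ≤ b → a * b ≤ m → 2 * a ≤ m → 2 * b ≤ m →
  suc m ≤ g + (a + b) → g ≤ s * s + s → s + N ≤ m → suc m < 2 * (suc m ∸ N) ^ 2
counting⇒bound m a b g s N 4≤m 1≤a 1≤b ab≤m 2a≤m 2b≤m m<g+[a+b] g≤s²+s s+N≤m = begin-strict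
  suc m                         <⟨ n<1+n (suc m) ⟩
  2 + m                         ≡⟨ +-comm 2 m ⟩
  m + 2                         ≤⟨ m+2≤2g+4 ⟩
  2 * g + 4                     ≤⟨ +-mono-≤ (*-monoʳ-≤ 2 g≤s²+s) (+-monoˡ-≤ 2 (*-monoʳ-≤ 2 1≤s)) ⟩
  2 * (s * s + s) + (2 * s + 2) ≡⟨ square s ⟨
  2 * (suc s ^ 2)               ≤⟨ *-monoʳ-≤ 2 (^-monoˡ-≤ 2 (m+n≤o⇒m≤o∸n (suc s) (s≤s s+N≤m))) ⟩
  2 * (suc m ∸ N) ^ 2           ∎
  where
  open ≤-Reasoning
  square : ∀ x → 2 * ((1 + x) * ((1 + x) * 1)) ≡ 2 * (x * x + x) + (2 * x + 2)
  square = solve-∀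
  m+2≤2g+4 : m + 2 ≤ 2 * g + 4
  m+2≤2g+4 = +-cancelˡ-≤ m _ _ (begin
    m + (m + 2)                 ≡⟨ double m ⟩
    2 * suc m                   ≤⟨ *-monoʳ-≤ 2 m<g+[a+b] ⟩
    2 * (g + (a + b))           ≡⟨ *-distribˡ-+ 2 g (a + b) ⟩
    2 * g + 2 * (a + b)         ≤⟨ +-monoʳ-≤ (2 * g) (2*[a+b]≤ m a b 1≤a 1≤b ab≤m 2a≤m 2b≤m) ⟩
    2 * g + (m + 4)             ≡⟨ +-comm (2 * g) (m + 4) ⟩
    m + 4 + 2 * g               ≡⟨ +-assoc m 4 (2 * g) ⟩
    m + (4 + 2 * g)             ≡⟨ cong (m +_) (+-comm 4 (2 * g)) ⟩
    m + (2 * g + 4)             ∎)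
    where
    double : ∀ m → m + (m + 2) ≡ 2 * (1 + m)
    double = solve-∀
  1≤s : 1 ≤ s
  1≤s = n≢0⇒n>0 λ s≡0 → <⇒≱ (m<m+n 4 z<s) (begin
    4 + 2       ≤⟨ +-monoˡ-≤ 2 4≤m ⟩
    m + 2       ≤⟨ m+2≤2g+4 ⟩
    2 * g + 4   ≤⟨ +-monoˡ-≤ 4 (*-monoʳ-≤ 2 (subst (λ x → g ≤ x * x + x) s≡0 g≤s²+s)) ⟩
    4           ∎)

lemma4 : (r k : ℕ) → Prime r → 5 ≤ r → 2 ≤ k → k ≤ r ∸ 2 →
    (numResidues r k < r) × (r < 2 * (r ∸ numResidues r k) ^ 2)
lemma4 (suc (suc r-2)) (suc (suc k-2)) r-prime (s≤s 4≤r-1) (s≤s (s≤s z≤n)) k≤r-2 =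
  s≤s N≤r-1 ,
  counting⇒bound r-1 (length (rootsOfUnity k)) (length (rootsOfUnity k-1)) (length generic) (length repeats) N
    4≤r-1 (1≤length-rootsOfUnity k) (1≤length-rootsOfUnity k-1)
    (length-rootsOfUnity-suc*≤ k-1) (2*length-rootsOfUnity-suc≤ k-1 k<r-1) (2*length-rootsOfUnity-suc≤ k-2 k-1<r-1)
    r≤generic+rootsOfUnity length-generic≤ s+N≤r-1
  where
  r-1 k-1 : ℕ
  r-1 = suc r-2
  k-1 = suc k-2
  open Modulo r-1
  open PrimeModulus r-prime
  open Exponent k-1
  N : ℕ
  N = numResidues r k
  k<r-1 : k < r-1
  k<r-1 = s≤s k≤r-2
  k-1<r-1 : k-1 < r-1
  k-1<r-1 = <-trans (n<1+n k-1) k<r-1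
  s+N≤r-1 : length repeats + N ≤ r-1
  s+N≤r-1 = ≤-trans (+-monoʳ-≤ (length repeats) length-deduplicate≤length-firsts)
                    (≤-reflexive (trans length-repeats+firsts length-units))
  N≤r-1 : N ≤ r-1
  N≤r-1 = m+n≤o⇒n≤o (length repeats) s+N≤r-1
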